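{- Let $n,k$ be positive integers with $\gcd(k,n)\neq 1$, and let $G$ be the graph whose vertices are the positive divisors of $n$, with an edge between $m$ and $m'$ (and $m'$ the parent of $m$) if and only if $m<m'$ and $k\cdot A_m=A_{m'}$; $G$ is a disjoint union of rooted trees, whose roots are exactly the divisors $m$ with $\gcd(k,n/m)=1$. Assign to each vertex $m$ the value $\alpha_m=R_k(A_m)$ if $\gcd(k,n/m)=1$, and $\alpha_m=\varphi(n/m)$ otherwise. Let $B$ be the set of vertices obtained by applying, in each tree of $G$, the following procedure: with $l$ the maximal level in the tree, first put into $B$ all vertices of level $l$; then for $t=1,\dots,l-1$, put a vertex of level $l-t$ into $B$ if and only if its value is nonzero and none of its children is in $B$. For each $m\in B$ with $\gcd(k,n/m)=1$, let $K_m\subset A_m$ be a $k$-free set of maximal cardinality $R_k(A_m)$. Then $$\overline{B}=\left(\bigsqcup_{m\in B,\ \gcd(k,n/m)\neq 1}A_m\right)\sqcup\left(\bigsqcup_{m\in B,\ \gcd(k,n/m)=1}K_m\right)$$ is a $k$-free subset of $\mathbb{Z}/n\mathbb{Z}$ of maximal cardinality, and its cardinality is $$R_k(n)=\sum_{m\in B,\ \gcd(k,n/m)\neq 1}\varphi\!\left(\frac{n}{m}\right)+\sum_{m\in B,\ \gcd(k,n/m)=1}R_k(A_m).$$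
   Context: Everything takes place in $\mathbb{Z}/n\mathbb{Z}$; a set $A\subset\mathbb{Z}/n\mathbb{Z}$ is $k$-free if for all $x\in A$, $kx\notin A$, and $R_k(n)$ is the maximal cardinality of a $k$-free subset of $\mathbb{Z}/n\mathbb{Z}$. For a divisor $m$ of $n$, $A_m=\{x\in\mathbb{Z}/n\mathbb{Z} : \gcd(x,n)=m\}$ (so $|A_m|=\varphi(n/m)$), $k\cdot A=\{ka : a\in A\}$, and $R_k(A_m)$ denotes the maximal cardinality of a $k$-free set contained in $A_m$. The level of a vertex in a rooted tree is $1$ plus the number of edges between it and the root. -}

module Defs where

open import Data.Nat using (ℕ; zero; suc; _*_; _<_; _≤_; NonZero; _⊔_; _≟_)
open import Data.Nat.DivMod using (_mod_; _/_)
open import Data.Nat.GCD using (gcd)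
open import Data.Nat.Divisibility using (_∣_; _∣?_)
open import Data.Fin using (Fin; toℕ)
open import Data.Fin.Properties using (all?)
open import Data.Fin.Subset using (Subset; _∈_; _∉_; _⊆_; ∣_∣; ⊤)
open import Data.Fin.Subset.Properties using (_∈?_; _⊆?_)
open import Data.Vec using ([]; _∷_; tabulate; lookup)
open import Data.List using (List; [_]; map; _++_; filter; foldr; length; upTo; applyUpTo)
open import Data.Bool.ListAction using (any)
open import Data.Nat.ListAction using (sum)
open import Data.Bool using (Bool; true; false; _∧_; not; T; if_then_else_)
open import Data.Product using (_×_; ∃)
open import Data.Sum using (_⊎_)
open import Relation.Nullary using (Dec; ¬_; does; ¬?)
open import Relation.Nullary.Decidable using (_×-dec_; _→-dec_; T?)
open import Relation.Binary.PropositionalEquality using (_≡_; _≢_)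
open import Function.Bundles using (_⇔_)

-- Z/nZ is Fin n; multiplication by k : x ↦ k x mod n
mulZ : (n k : ℕ) {{_ : NonZero n}} → Fin n → Fin n
mulZ n k x = (k * toℕ x) mod n

KFree : (n k : ℕ) {{_ : NonZero n}} → Subset n → Set
KFree n k S = ∀ x → x ∈ S → mulZ n k x ∉ S

kfree? : (n k : ℕ) {{_ : NonZero n}} → (S : Subset n) → Dec (KFree n k S)
kfree? n k S = all? (λ x → (x ∈? S) →-dec ¬? (mulZ n k x ∈? S))

allSubsets : ∀ n → List (Subset n)
allSubsets zero = [ [] ]
allSubsets (suc n) = map (true ∷_) (allSubsets n) ++ map (false ∷_) (allSubsets n)

RkSet : (n k : ℕ) {{_ : NonZero n}} → Subset n → ℕ
RkSet n k A =
  foldr _⊔_ 0 (map ∣_∣ (filter (λ S → (S ⊆? A) ×-dec kfree? n k S) (allSubsets n)))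

Rk : (n k : ℕ) {{_ : NonZero n}} → ℕ
Rk n k = RkSet n k ⊤

Adiv : (n m : ℕ) → Subset n
Adiv n m = tabulate (λ x → does (gcd (toℕ x) n ≟ m))

-- n / m (only used for divisors m ≥ 1; value at m = 0 irrelevant)
_/ᵈ_ : ℕ → ℕ → ℕ
n /ᵈ zero = 0
n /ᵈ suc m = n / suc m

φ : ℕ → ℕ
φ d = length (filter (λ i → gcd i d ≟ 1) (upTo d))

divisors : ℕ → List ℕ
divisors n = filter (_∣? n) (applyUpTo suc n)

Edge : (n k : ℕ) {{_ : NonZero n}} → ℕ → ℕ → Set
Edge n k m m' =
  (m ∣ n) × (m' ∣ n) × m < m' ×
  (∀ y → (y ∈ Adiv n m') ⇔ (∃ λ x → x ∈ Adiv n m × mulZ n k x ≡ y))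

IsRoot : (n k : ℕ) {{_ : NonZero n}} → ℕ → Set
IsRoot n k r = (r ∣ n) × (∀ p → ¬ Edge n k r p)

data InTree (n k : ℕ) {{_ : NonZero n}} (r : ℕ) : ℕ → ℕ → Set where
  root  : IsRoot n k r → InTree n k r r 1
  child : ∀ {m p l} → Edge n k m p → InTree n k r p l → InTree n k r m (suc l)

MaxLevel : (n k : ℕ) {{_ : NonZero n}} → ℕ → ℕ → Set
MaxLevel n k r l =
  (∃ λ m → InTree n k r m l) × (∀ m l' → InTree n k r m l' → l' ≤ l)

cop : (n k m : ℕ) → Bool
cop n k m = does (gcd k (n /ᵈ m) ≟ 1)

α : (n k : ℕ) {{_ : NonZero n}} → ℕ → ℕ
α n k m = if cop n k m then RkSet n k (Adiv n m) else φ (n /ᵈ m)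

-- B (as a membership function on vertices) is the set produced by the
-- procedure: in the tree (root r, maximal level l), a vertex m of level lm
-- is in B iff lm = l, or lm < l, α_m ≠ 0 and no child of m is in B.
IsProcedureSet : (n k : ℕ) {{_ : NonZero n}} → (ℕ → Bool) → Set
IsProcedureSet n k B =
  ∀ m r lm l → m ∣ n → InTree n k r m lm → MaxLevel n k r l →
    (T (B m) ⇔ (lm ≡ l ⊎ (lm < l × α n k m ≢ 0 × (∀ c → Edge n k c m → ¬ T (B c)))))

IsMaxKFreeIn : (n k : ℕ) {{_ : NonZero n}} → Subset n → Subset n → Set
IsMaxKFreeIn n k A K = K ⊆ A × KFree n k K × ∣ K ∣ ≡ RkSet n k A

Bbar : (n k : ℕ) → (ℕ → Bool) → (ℕ → Subset n) → Subset n
Bbar n k B K = tabulate (λ x →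
  any (λ m → B m ∧ (if cop n k m then lookup (K m) x else lookup (Adiv n m) x))
      (divisors n))

sumNonCop : (n k : ℕ) → (ℕ → Bool) → ℕ
sumNonCop n k B =
  sum (map (λ m → φ (n /ᵈ m)) (filter (λ m → T? (B m ∧ not (cop n k m))) (divisors n)))

sumCop : (n k : ℕ) {{_ : NonZero n}} → (ℕ → Bool) → ℕ
sumCop n k B =
  sum (map (λ m → RkSet n k (Adiv n m)) (filter (λ m → T? (B m ∧ cop n k m)) (divisors n)))

{-# OPTIONS --safe #-}
-- Let A_m = {x : gcd(x, n) = m}. Multiplication by k maps A_m onto A_m′ with
-- m′ = gcd(km, n) = gcd(k, n/m)·m: onto A_m itself at the roots of G, and onto the class of
-- the parent otherwise. Hence B̄ is k-free: inside a root class it is the k-free set K_m, and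
-- by construction no vertex of B has its parent in B.
-- Conversely let S be k-free and s_d = |S ∩ A_d|. Then s_d ≤ α_d, and for a non-root c the
-- map x ↦ kx sends A_c ∖ S onto a superset of S ∩ A_parent, so s_parent ≤ φ(n/c) − s_c.
-- A vertex d ∉ B has α_d = 0 or a child c ∈ B, to which s_d is charged; as every vertex has a
-- single parent, summing over the divisors gives |S| ≤ Σ_{d ∈ B} α_d = |B̄|.
module Submission where

open import Defs
open import Data.Nat using (ℕ; _+_; _<_; NonZero)
open import Data.Nat.GCD using (gcd)
open import Data.Nat.Divisibility using (_∣_)
open import Data.Fin.Subset using (Subset; ∣_∣)
open import Data.Bool using (Bool; T)
open import Data.Product using (_×_)
open import Relation.Binary.PropositionalEquality using (_≡_; _≢_)

open import Data.Bool using (true; false; _∧_; not; if_then_else_)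
open import Data.Bool.ListAction using (any)
open import Data.Bool.Properties using (T?; T-≡; T-∧; ∧-identityʳ; ∧-zeroʳ; ∧-idem)
open import Data.Empty using (⊥-elim)
open import Data.Fin using (Fin; zero; suc; toℕ; fromℕ<)
open import Data.Fin.Properties using (toℕ-fromℕ<; toℕ-injective; toℕ<n)
import Data.Fin.Properties as Fin
open import Data.Fin.Subset using (_∈_; _⊆_)
open import Data.Fin.Subset.Properties using (_⊆?_; ⊆⊤)
open import Data.List using ([]; _∷_; map; filter; length; applyUpTo)
open import Data.List.Membership.Propositional using (lose; find) renaming (_∈_ to _∈ₗ_)
open import Data.List.Membership.Propositional.Properties
  using (∈-map⁺; ∈-++⁺ˡ; ∈-++⁺ʳ; ∈-filter⁺; ∈-filter⁻; ∈-applyUpTo⁺)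
open import Data.List.Properties using (foldr-preservesᵒ; foldr-preservesᵇ)
open import Data.List.Relation.Unary.Any using (here)
open import Data.List.Relation.Unary.Any.Properties using (any⁺; any⁻)
import Data.List.Relation.Unary.Any.Properties as Any
import Data.List.Relation.Unary.All as All
import Data.List.Relation.Unary.All.Properties as All
open import Data.Nat using (zero; suc; _*_; _∸_; _≤_; _⊔_; z≤n; s≤s; ≢-nonZero; ≢-nonZero⁻¹)
open import Data.Nat.Coprimality
  using (Coprime; coprime-divisor; coprime-Bézout; coprime?; gcd≡1⇒coprime; coprime⇒gcd≡1; GCD≡1⇒coprime)
import Data.Nat.Coprimality as Coprime
open import Data.Nat.Divisibility
open import Data.Nat.DivMod
  using (_%_; _/_; _mod_; [m+kn]%n≡m%n; m%n*o≡m*o%[n*o]; m/n*n≡m; %-congʳ; m%n<n; %-distribˡ-*;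
         m%n%n≡m%n; m<n⇒m%n≡m; m*[n/m]≡n)
open import Data.Nat.GCD
import Data.Nat.ListAction as ListAction
open import Data.Nat.Properties
open import Algebra.Properties.CommutativeMonoid.Sum +-0-commutativeMonoid
  using (sum; sum-syntax; sum-cong-≗; ∑-distrib-+; ∑-comm; sum-replicate-zero)
open import Algebra.Properties.Semiring.Sum +-*-semiring using (*-distribˡ-sum)
open import Algebra.Properties.CommutativeSemigroup *-commutativeSemigroup using (x∙yz≈y∙xz)
open import Data.Nat.Tactic.RingSolver using (solve-∀)
open import Data.Product using (∃; _,_; proj₁; proj₂)
open import Data.Sum using (_⊎_; inj₁; inj₂; [_,_]′)
open import Data.Vec using (_∷_; []; lookup; tabulate)
open import Data.Vec.Functional using (Vector)
open import Data.Vec.Properties using (lookup∘tabulate; []=⇒lookup; lookup⇒[]=)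
open import Function using (_∘_)
open import Function.Bundles using (Equivalence; mk⇔)
open import Level using (0ℓ)
open import Relation.Binary.PropositionalEquality
open import Relation.Nullary using (Dec; does; ¬_; yes; no; contradiction; ¬?)
open import Relation.Nullary.Decidable using (dec-true; dec-false; does-⇔; _×-dec_)
open import Relation.Unary using (Pred; Decidable)

-- Indicators, finite sums and counting

⟦_⟧ : Bool → ℕ
⟦ true ⟧ = 1
⟦ false ⟧ = 0

⟦T⟧ : ∀ {b} → T b → ⟦ b ⟧ ≡ 1
⟦T⟧ {true} _ = refl

T-ext : ∀ {a b} → (T a → T b) → (T b → T a) → a ≡ b
T-ext {false} {false} _ _ = refl
T-ext {false} {true} _ b⇒a = ⊥-elim (b⇒a _)
T-ext {true} {false} a⇒b _ = ⊥-elim (a⇒b _)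
T-ext {true} {true} _ _ = refl

¬T⇒T-not : ∀ {b} → ¬ T b → T (not b)
¬T⇒T-not {false} _ = _
¬T⇒T-not {true} ¬b = ¬b _

⟦∧⟧≤⟦⟧ : ∀ a b → ⟦ a ∧ b ⟧ ≤ ⟦ a ⟧
⟦∧⟧≤⟦⟧ false b = z≤n
⟦∧⟧≤⟦⟧ true false = z≤n
⟦∧⟧≤⟦⟧ true true = ≤-refl

⟦b⟧*-cong : ∀ b {x y} → (T b → x ≡ y) → ⟦ b ⟧ * x ≡ ⟦ b ⟧ * y
⟦b⟧*-cong false _ = refl
⟦b⟧*-cong true x≡y = cong (_+ 0) (x≡y _)

⟦b⟧*if-split : ∀ b c x y → ⟦ b ⟧ * (if c then y else x) ≡ ⟦ b ∧ not c ⟧ * x + ⟦ b ∧ c ⟧ * y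
⟦b⟧*if-split false c x y = refl
⟦b⟧*if-split true false x y = sym (+-identityʳ (x + 0))
⟦b⟧*if-split true true x y = refl

⟦b⟧*w+leftover≤ : ∀ b c {w x y} → (T c → w ≤ y) → (¬ T c → w ≤ x) →
  ⟦ b ⟧ * w + ⟦ b ∧ not c ⟧ * (x ∸ w) ≤ ⟦ b ⟧ * (if c then y else x)
⟦b⟧*w+leftover≤ false c _ _ = z≤n
⟦b⟧*w+leftover≤ true true {w} w≤y _ = +-monoˡ-≤ 0 (≤-trans (≤-reflexive (+-identityʳ w)) (w≤y _))
⟦b⟧*w+leftover≤ true false {w} {x} _ w≤x = begin
  w + 0 + (x ∸ w + 0)  ≡⟨ cong₂ _+_ (+-identityʳ w) (+-identityʳ (x ∸ w)) ⟩
  w + (x ∸ w)          ≡⟨ m+[n∸m]≡n (w≤x λ ()) ⟩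
  x                    ≡⟨ +-identityʳ x ⟨
  x + 0                ∎
  where open ≤-Reasoning

sum-mono-≤ : ∀ {N} {f g : Vector ℕ N} → (∀ i → f i ≤ g i) → sum f ≤ sum g
sum-mono-≤ {zero} f≤g = z≤n
sum-mono-≤ {suc N} f≤g = +-mono-≤ (f≤g zero) (sum-mono-≤ (f≤g ∘ suc))

term≤sum : ∀ {N} (f : Vector ℕ N) i → f i ≤ sum f
term≤sum f zero = m≤m+n (f zero) _
term≤sum f (suc i) = ≤-trans (term≤sum (f ∘ suc) i) (m≤n+m _ (f zero))

sum-select : ∀ {N} (f : Vector ℕ N) j → (∀ i → i ≢ j → f i ≡ 0) → sum f ≡ f j
sum-select {suc N} f zero f≡0 =
  trans (cong (f zero +_) (trans (sum-cong-≗ (λ i → f≡0 (suc i) λ ())) (sum-replicate-zero N)))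
        (+-identityʳ (f zero))
sum-select {suc N} f (suc j) f≡0 =
  trans (cong (_+ sum (f ∘ suc)) (f≡0 zero λ ()))
        (sum-select (f ∘ suc) j (λ i i≢j → f≡0 (suc i) (i≢j ∘ Fin.suc-injective)))

sumBelow : ℕ → (ℕ → ℕ) → ℕ
sumBelow N f = ∑[ i < N ] f (toℕ i)

sumBelow-select : ∀ N (f : ℕ → ℕ) {c} → c < N → (∀ d → d < N → d ≢ c → f d ≡ 0) →
  sumBelow N f ≡ f c
sumBelow-select N f {c} c<N f≡0 =
  trans (sum-select (f ∘ toℕ) (fromℕ< c<N) λ i i≢c → f≡0 (toℕ i) (toℕ<n i) λ i≡c →
           i≢c (toℕ-injective (trans i≡c (sym (toℕ-fromℕ< c<N)))))
        (cong f (toℕ-fromℕ< c<N))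

term≤sumBelow : ∀ N (f : ℕ → ℕ) {c} → c < N → f c ≤ sumBelow N f
term≤sumBelow N f c<N =
  subst (_≤ sumBelow N f) (cong f (toℕ-fromℕ< c<N)) (term≤sum (f ∘ toℕ) (fromℕ< c<N))

sumBelow-+ : ∀ a b (f : ℕ → ℕ) → sumBelow (a + b) f ≡ sumBelow a f + sumBelow b (λ i → f (a + i))
sumBelow-+ zero b f = refl
sumBelow-+ (suc a) b f =
  trans (cong (f 0 +_) (sumBelow-+ a b (f ∘ suc))) (sym (+-assoc (f 0) _ _))

sumBelow-* : ∀ a b (f : ℕ → ℕ) →
  sumBelow (a * b) f ≡ sumBelow a (λ u → sumBelow b (λ r → f (u * b + r)))
sumBelow-* zero b f = refl
sumBelow-* (suc a) b f = begin
  sumBelow (b + a * b) f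
    ≡⟨ sumBelow-+ b (a * b) f ⟩
  sumBelow b f + sumBelow (a * b) (λ i → f (b + i))
    ≡⟨ cong (sumBelow b f +_) (sumBelow-* a b (λ i → f (b + i))) ⟩
  sumBelow b f + sumBelow a (λ u → sumBelow b (λ r → f (b + (u * b + r))))
    ≡⟨ cong (sumBelow b f +_) (sum-cong-≗ {a} λ u → sum-cong-≗ {b} λ r →
         cong f (sym (+-assoc b (toℕ u * b) (toℕ r)))) ⟩
  sumBelow b f + sumBelow a (λ u → sumBelow b (λ r → f (suc u * b + r))) ∎
  where open ≡-Reasoning

module _ {A : Set} where

  sum-map-filter : ∀ {P : Pred A 0ℓ} (P? : Decidable P) (g : A → ℕ) xs →
    ListAction.sum (map g (filter P? xs)) ≡ ListAction.sum (map (λ x → ⟦ does (P? x) ⟧ * g x) xs)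
  sum-map-filter P? g [] = refl
  sum-map-filter P? g (x ∷ xs) with does (P? x)
  ... | true = cong₂ _+_ (sym (+-identityʳ (g x))) (sum-map-filter P? g xs)
  ... | false = sum-map-filter P? g xs

  length-filter-applyUpTo : ∀ {P : Pred A 0ℓ} (P? : Decidable P) (f : ℕ → A) N →
    length (filter P? (applyUpTo f N)) ≡ sumBelow N (λ i → ⟦ does (P? (f i)) ⟧)
  length-filter-applyUpTo P? f zero = refl
  length-filter-applyUpTo P? f (suc N) with does (P? (f 0))
  ... | true = cong suc (length-filter-applyUpTo P? (f ∘ suc) N)
  ... | false = length-filter-applyUpTo P? (f ∘ suc) N

sum-map-applyUpTo : ∀ {A : Set} (g : A → ℕ) f N →
  ListAction.sum (map g (applyUpTo f N)) ≡ sumBelow N (g ∘ f)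
sum-map-applyUpTo g f zero = refl
sum-map-applyUpTo g f (suc N) = cong (g (f 0) +_) (sum-map-applyUpTo g (f ∘ suc) N)

count : ∀ {m} → (Fin m → Bool) → ℕ
count P = sum (⟦_⟧ ∘ P)

∣p∣≡count : ∀ {m} (p : Subset m) → ∣ p ∣ ≡ count (lookup p)
∣p∣≡count [] = refl
∣p∣≡count (true ∷ p) = cong suc (∣p∣≡count p)
∣p∣≡count (false ∷ p) = ∣p∣≡count p

∈⇒T-lookup : ∀ {m} {p : Subset m} {x} → x ∈ p → T (lookup p x)
∈⇒T-lookup x∈p = Equivalence.from T-≡ ([]=⇒lookup x∈p)

T-lookup⇒∈ : ∀ {m} {p : Subset m} {x} → T (lookup p x) → x ∈ p
T-lookup⇒∈ {p = p} {x} t = lookup⇒[]= x p (Equivalence.to T-≡ t)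

count-split : ∀ {m} (P Q : Fin m → Bool) →
  count P ≡ count (λ x → P x ∧ Q x) + count (λ x → P x ∧ not (Q x))
count-split P Q = trans (sum-cong-≗ λ x → split (P x) (Q x)) (∑-distrib-+ (⟦_⟧ ∘ (λ x → P x ∧ Q x)) _)
  where
  split : ∀ a b → ⟦ a ⟧ ≡ ⟦ a ∧ b ⟧ + ⟦ a ∧ not b ⟧
  split true true = refl
  split true false = refl
  split false b = refl

count-const-∧ : ∀ {m} b (Q : Fin m → Bool) → count (λ x → b ∧ Q x) ≡ ⟦ b ⟧ * count Q
count-const-∧ {m} false Q = sum-replicate-zero m
count-const-∧ true Q = sym (+-identityʳ (count Q))

count-surjection : ∀ {a b} (P : Fin a → Bool) (Q : Fin b → Bool) (g : Fin a → Fin b) →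
  (∀ y → T (Q y) → ∃ λ x → T (P x) × g x ≡ y) → count Q ≤ count P
count-surjection {a} {b} P Q g onto = begin
  ∑[ y < b ] ⟦ Q y ⟧                        ≤⟨ sum-mono-≤ fibre-inhabited ⟩
  ∑[ y < b ] ∑[ x < a ] ⟦ P x ∧ g x == y ⟧  ≡⟨ ∑-comm {b} {a} _ ⟩
  ∑[ x < a ] ∑[ y < b ] ⟦ P x ∧ g x == y ⟧  ≡⟨ sum-cong-≗ fibre-singleton ⟩
  ∑[ x < a ] ⟦ P x ⟧                        ∎
  where
  open ≤-Reasoning
  _==_ : Fin b → Fin b → Bool
  y == y' = does (y Fin.≟ y')
  at-image : ∀ x → ⟦ P x ∧ g x == g x ⟧ ≡ ⟦ P x ⟧
  at-image x = trans (cong (λ c → ⟦ P x ∧ c ⟧) (dec-true (g x Fin.≟ g x) refl))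
                     (cong ⟦_⟧ (∧-identityʳ (P x)))
  fibre-singleton : ∀ x → ∑[ y < b ] ⟦ P x ∧ g x == y ⟧ ≡ ⟦ P x ⟧
  fibre-singleton x = trans (sum-select _ (g x) off-image) (at-image x)
    where
    off-image : ∀ y → y ≢ g x → ⟦ P x ∧ g x == y ⟧ ≡ 0
    off-image y y≢gx rewrite dec-false (g x Fin.≟ y) (y≢gx ∘ sym) = cong ⟦_⟧ (∧-zeroʳ (P x))
  fibre-inhabited : ∀ y → ⟦ Q y ⟧ ≤ ∑[ x < a ] ⟦ P x ∧ g x == y ⟧
  fibre-inhabited y with Q y in eq
  ... | false = z≤n
  ... | true with onto y (subst T (sym eq) _)
  ...   | x , Px , refl = ≤-trans (≤-reflexive (sym (trans (at-image x) (⟦T⟧ Px)))) (term≤sum _ x)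

allSubsets-complete : ∀ {m} (S : Subset m) → S ∈ₗ allSubsets m
allSubsets-complete [] = here refl
allSubsets-complete {suc m} (true ∷ S) = ∈-++⁺ˡ (∈-map⁺ (true ∷_) (allSubsets-complete S))
allSubsets-complete {suc m} (false ∷ S) =
  ∈-++⁺ʳ (map (true ∷_) (allSubsets m)) (∈-map⁺ (false ∷_) (allSubsets-complete S))

-- Arithmetic

gcd[m%n,n]≡gcd[m,n] : ∀ m n .{{_ : NonZero n}} → gcd (m % n) n ≡ gcd m n
gcd[m%n,n]≡gcd[m,n] m n = ∣-antisym
  (gcd-greatest (∣n∣m%n⇒∣m (gcd[m,n]∣n (m % n) n) (gcd[m,n]∣m (m % n) n)) (gcd[m,n]∣n (m % n) n))
  (gcd-greatest (%-presˡ-∣ (gcd[m,n]∣m m n) (gcd[m,n]∣n m n)) (gcd[m,n]∣n m n))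

gcd[km,n]≡gcd[k*gcd[m,n],n] : ∀ k m n → gcd (k * m) n ≡ gcd (k * gcd m n) n
gcd[km,n]≡gcd[k*gcd[m,n],n] k m n = ∣-antisym
  (gcd-greatest ∣k*gcd[m,n] (gcd[m,n]∣n (k * m) n))
  (gcd-greatest (∣-trans (gcd[m,n]∣m (k * gcd m n) n) (*-monoʳ-∣ k (gcd[m,n]∣m m n)))
                (gcd[m,n]∣n (k * gcd m n) n))
  where
  ∣k*gcd[m,n] : gcd (k * m) n ∣ k * gcd m n
  ∣k*gcd[m,n] = subst (gcd (k * m) n ∣_) (sym (c*gcd[m,n]≡gcd[cm,cn] k m n))
    (gcd-greatest (gcd[m,n]∣m (k * m) n) (∣n⇒∣m*n k (gcd[m,n]∣n (k * m) n)))

gcd[am,bm]≡gcd[a,b]*m : ∀ a b m → gcd (a * m) (b * m) ≡ gcd a b * m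
gcd[am,bm]≡gcd[a,b]*m a b m = begin
  gcd (a * m) (b * m) ≡⟨ cong₂ gcd (*-comm a m) (*-comm b m) ⟩
  gcd (m * a) (m * b) ≡⟨ c*gcd[m,n]≡gcd[cm,cn] m a b ⟨
  m * gcd a b         ≡⟨ *-comm m (gcd a b) ⟩
  gcd a b * m         ∎
  where open ≡-Reasoning

gcd[m,n]≡m : ∀ {m n} → m ∣ n → gcd m n ≡ m
gcd[m,n]≡m m∣n = ∣-antisym (gcd[m,n]∣m _ _) (gcd-greatest ∣-refl m∣n)

[m*[n%d]]%d≡[m*n]%d : ∀ m n d .{{_ : NonZero d}} → (m * (n % d)) % d ≡ (m * n) % d
[m*[n%d]]%d≡[m*n]%d m n d = begin
  (m * (n % d)) % d               ≡⟨ %-distribˡ-* m (n % d) d ⟩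
  ((m % d) * (n % d % d)) % d      ≡⟨ cong (λ z → ((m % d) * z) % d) (m%n%n≡m%n n d) ⟩
  ((m % d) * (n % d)) % d          ≡⟨ %-distribˡ-* m n d ⟨
  (m * n) % d                     ∎
  where open ≡-Reasoning

gcd[ac,bc]≡c⇒coprime : ∀ a b c .{{_ : NonZero c}} → gcd (a * c) (b * c) ≡ c → Coprime a b
gcd[ac,bc]≡c⇒coprime a b c gcd≡c = gcd≡1⇒coprime (*-cancelʳ-≡ (gcd a b) 1 c (begin
  gcd a b * c           ≡⟨ gcd[am,bm]≡gcd[a,b]*m a b c ⟨
  gcd (a * c) (b * c)   ≡⟨ gcd≡c ⟩
  c                     ≡⟨ *-identityˡ c ⟨
  1 * c                 ∎))
  where open ≡-Reasoning

congruence-coprime : ∀ a {w v M} .{{_ : NonZero M}} → (a * w) % M ≡ v % M → Coprime v M → Coprime w M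
congruence-coprime a aw≡v v⊥M (d∣w , d∣M) =
  v⊥M (∣n∣m%n⇒∣m d∣M (subst (_ ∣_) aw≡v (%-presˡ-∣ (∣n⇒∣m*n a d∣w) d∣M)) , d∣M)

coprime-*ˡ : ∀ {a b c} → Coprime a c → Coprime b c → Coprime (a * b) c
coprime-*ˡ {a} {b} {c} a⊥c b⊥c (d∣ab , d∣c) = b⊥c (coprime-divisor d⊥a d∣ab , d∣c)
  where
  d⊥a : Coprime _ a
  d⊥a (e∣d , e∣a) = a⊥c (e∣a , ∣-trans e∣d d∣c)

coprime-∣ˡ : ∀ {a b c} → Coprime a c → b ∣ a → Coprime b c
coprime-∣ˡ a⊥c b∣a (e∣b , e∣c) = a⊥c (∣-trans e∣b b∣a , e∣c)

coprime⇒*∣ : ∀ {a b N} → Coprime a b → a ∣ N → b ∣ N → a * b ∣ N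
coprime⇒*∣ {a} {b} a⊥b (divides q refl) b∣qa = subst (a * b ∣_) (*-comm a q)
  (*-monoʳ-∣ a (coprime-divisor (Coprime.sym a⊥b) (subst (b ∣_) (*-comm q a) b∣qa)))

bounded-max : ∀ {P : ℕ → Set} → (∀ x → Dec (P x)) → ∀ {x} b → x ≤ b → P x →
  ∃ λ R → P R × (∀ y → y ≤ b → P y → y ≤ R)
bounded-max {P} P? b x≤b Px with P? b
... | yes Pb = b , Pb , λ _ y≤b _ → y≤b
bounded-max {P} P? zero z≤n Px | no ¬Pb = contradiction Px ¬Pb
bounded-max {P} P? {x} (suc b) x≤b Px | no ¬Pb
  with R , PR , max ← bounded-max P? b (m<1+n⇒m≤n (≤∧≢⇒< x≤b (λ { refl → ¬Pb Px }))) Px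
  = R , PR , λ y y≤ Py → max y (m<1+n⇒m≤n (≤∧≢⇒< y≤ (λ { refl → ¬Pb Py }))) Py

-- R is the largest divisor of N coprime to M and w: a common divisor d of w + M R and N would
-- make d R another one.
coprime-lift : ∀ w M N .{{_ : NonZero N}} → Coprime w M → ∃ λ R → Coprime (w + M * R) N
coprime-lift w M N w⊥M =
  lift (bounded-max P? N (∣⇒≤ (1∣ N)) (Coprime.1-coprimeTo M , Coprime.1-coprimeTo w , 1∣ N))
  where
  P : ℕ → Set
  P R = Coprime R M × Coprime R w × R ∣ N
  P? : ∀ x → Dec (P x)
  P? x = coprime? x M ×-dec coprime? x w ×-dec (x ∣? N)
  lift : (∃ λ R → P R × (∀ y → y ≤ N → P y → y ≤ R)) → ∃ λ R → Coprime (w + M * R) N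
  lift (R , (R⊥M , R⊥w , R∣N) , maximal) = R , λ (d∣u , d∣N) → d≡1 d∣u d∣N
    where
    u = w + M * R
    ∣u∣w⇒∣MR : ∀ {e} → e ∣ u → e ∣ w → e ∣ M * R
    ∣u∣w⇒∣MR = ∣m+n∣m⇒∣n
    ∣u∣MR⇒∣w : ∀ {e} → e ∣ u → e ∣ M * R → e ∣ w
    ∣u∣MR⇒∣w {e} e∣u = ∣m+n∣m⇒∣n (subst (e ∣_) (+-comm w (M * R)) e∣u)
    d≡1 : ∀ {d} → d ∣ u → d ∣ N → d ≡ 1
    d≡1 {d} d∣u d∣N = ≤-antisym (*-cancelʳ-≤ d 1 R dR≤R) (n≢0⇒n>0 d≢0)
      where
      d⊥M : Coprime d M
      d⊥M (e∣d , e∣M) = w⊥M (∣u∣MR⇒∣w (∣-trans e∣d d∣u) (∣m⇒∣m*n R e∣M) , e∣M)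
      d⊥w : Coprime d w
      d⊥w (e∣d , e∣w) = R⊥w (coprime-divisor (coprime-∣ˡ w⊥M e∣w) (∣u∣w⇒∣MR (∣-trans e∣d d∣u) e∣w) , e∣w)
      d⊥R : Coprime d R
      d⊥R (e∣d , e∣R) = d⊥w (e∣d , ∣u∣MR⇒∣w (∣-trans e∣d d∣u) (∣n⇒∣m*n M e∣R))
      dR∣N : d * R ∣ N
      dR∣N = coprime⇒*∣ d⊥R d∣N R∣N
      instance
        R≢0 : NonZero R
        R≢0 = ≢-nonZero λ { refl → ≢-nonZero⁻¹ N (0∣⇒≡0 R∣N) }
      d≢0 : d ≢ 0
      d≢0 refl = ≢-nonZero⁻¹ N (0∣⇒≡0 d∣N)
      dR≤R : d * R ≤ 1 * R
      dR≤R = subst (d * R ≤_) (sym (*-identityˡ R))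
        (maximal (d * R) (∣⇒≤ dR∣N) (coprime-*ˡ d⊥M R⊥M , coprime-*ˡ d⊥w R⊥w , dR∣N))

linear-congruence : ∀ a M .{{_ : NonZero M}} → Coprime a M → ∀ v → ∃ λ w → (a * w) % M ≡ v % M
linear-congruence a M@(suc M′) aM v with coprime-Bézout aM
... | Bézout.+- x y 1+yM≡xa = x * v , (begin
  (a * (x * v)) % M  ≡⟨ cong (_% M) (trans (lhs a x v) (cong (_* v) (sym 1+yM≡xa))) ⟩
  ((1 + y * M) * v) % M ≡⟨ cong (_% M) (rhs y M v) ⟩
  (v + y * v * M) % M ≡⟨ [m+kn]%n≡m%n v (y * v) M ⟩
  v % M              ∎)
  where
  open ≡-Reasoning
  lhs : ∀ a x v → a * (x * v) ≡ x * a * v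
  lhs = solve-∀
  rhs : ∀ y M v → (1 + y * M) * v ≡ v + y * v * M
  rhs = solve-∀
... | Bézout.-+ x y 1+xa≡yM = x * v * M′ , (begin
  (a * (x * v * M′)) % M               ≡⟨ [m+kn]%n≡m%n (a * (x * v * M′)) v M ⟨
  (a * (x * v * M′) + v * M) % M        ≡⟨ cong (_% M) (lhs a x v M′) ⟩
  ((1 + x * a) * (v * M′) + v) % M      ≡⟨ cong (λ z → (z * (v * M′) + v) % M) 1+xa≡yM ⟩
  (y * M * (v * M′) + v) % M            ≡⟨ cong (_% M) (rhs y M v M′) ⟩
  (v + y * v * M′ * M) % M              ≡⟨ [m+kn]%n≡m%n v (y * v * M′) M ⟩
  v % M                                ∎)
  where
  open ≡-Reasoning
  lhs : ∀ a x v M′ → a * (x * v * M′) + v * suc M′ ≡ (1 + x * a) * (v * M′) + v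
  lhs = solve-∀
  rhs : ∀ y M v M′ → y * M * (v * M′) + v ≡ v + y * v * M′ * M
  rhs = solve-∀

-- With g = gcd k N, k = k′ g and N = M g: write y = v g m, solve k′ w ≡ v (mod M), and lift w
-- to a unit u modulo N.
k*-onto-gcd-class : ∀ k m N {n} .{{_ : NonZero n}} → m * N ≡ n → ∀ y →
  gcd y n ≡ gcd k N * m →
  ∃ λ u → Coprime u N × (k * (m * u)) % n ≡ y % n
k*-onto-gcd-class k m N refl y gcd[y,mN]≡gm = u , u⊥N , k[mu]≡y
  where
  g = gcd k N
  instance
    m≢0 : NonZero m
    m≢0 = m*n≢0⇒m≢0 m
    N≢0 : NonZero N
    N≢0 = m*n≢0⇒n≢0 m
    g≢0 : NonZero g
    g≢0 = ≢-nonZero (gcd[m,n]≢0 k N (inj₂ (≢-nonZero⁻¹ N)))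
    gm≢0 : NonZero (g * m)
    gm≢0 = m*n≢0 g m
    M≢0 : NonZero (N / g)
    M≢0 = ≢-nonZero (n/gcd[m,n]≢0 k N)
    M[gm]≢0 : NonZero (N / g * (g * m))
    M[gm]≢0 = m*n≢0 (N / g) (g * m)
  k′ = k / g
  M = N / g
  k≡k′g : k ≡ k′ * g
  k≡k′g = sym (m/n*n≡m (gcd[m,n]∣m k N))
  N≡Mg : N ≡ M * g
  N≡Mg = sym (m/n*n≡m (gcd[m,n]∣n k N))
  mN≡M[gm] : m * N ≡ M * (g * m)
  mN≡M[gm] = trans (cong (m *_) N≡Mg) (reorder m M g)
    where
    reorder : ∀ m M g → m * (M * g) ≡ M * (g * m)
    reorder = solve-∀
  k′⊥M : Coprime k′ M
  k′⊥M = GCD≡1⇒coprime (GCD-/gcd k N)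
  v = y / (g * m)
  y≡v[gm] : y ≡ v * (g * m)
  y≡v[gm] = sym (m/n*n≡m (subst (_∣ y) gcd[y,mN]≡gm (gcd[m,n]∣m y (m * N))))
  v⊥M : Coprime v M
  v⊥M = gcd[ac,bc]≡c⇒coprime v M (g * m) (trans (sym (cong₂ gcd y≡v[gm] mN≡M[gm])) gcd[y,mN]≡gm)
  w = proj₁ (linear-congruence k′ M k′⊥M v)
  k′w≡v : (k′ * w) % M ≡ v % M
  k′w≡v = proj₂ (linear-congruence k′ M k′⊥M v)
  w⊥M : Coprime w M
  w⊥M = congruence-coprime k′ k′w≡v v⊥M
  R = proj₁ (coprime-lift w M N w⊥M)
  u = w + M * R
  u⊥N : Coprime u N
  u⊥N = proj₂ (coprime-lift w M N w⊥M)
  k[mu]≡y : (k * (m * u)) % (m * N) ≡ y % (m * N)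
  k[mu]≡y = begin
    (k * (m * u)) % (m * N)
      ≡⟨ cong (λ z → (z * (m * u)) % (m * N)) k≡k′g ⟩
    (k′ * g * (m * (w + M * R))) % (m * N)
      ≡⟨ cong (_% (m * N)) (expand k′ g m w M R) ⟩
    (k′ * w * (g * m) + k′ * R * (m * (M * g))) % (m * N)
      ≡⟨ cong (λ z → (k′ * w * (g * m) + k′ * R * (m * z)) % (m * N)) N≡Mg ⟨
    (k′ * w * (g * m) + k′ * R * (m * N)) % (m * N)
      ≡⟨ [m+kn]%n≡m%n (k′ * w * (g * m)) (k′ * R) (m * N) ⟩
    (k′ * w * (g * m)) % (m * N)
      ≡⟨ %-congʳ mN≡M[gm] ⟩
    (k′ * w * (g * m)) % (M * (g * m))
      ≡⟨ m%n*o≡m*o%[n*o] (k′ * w) M (g * m) ⟨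
    (k′ * w) % M * (g * m)
      ≡⟨ cong (_* (g * m)) k′w≡v ⟩
    v % M * (g * m)
      ≡⟨ m%n*o≡m*o%[n*o] v M (g * m) ⟩
    (v * (g * m)) % (M * (g * m))
      ≡⟨ %-congʳ mN≡M[gm] ⟨
    (v * (g * m)) % (m * N)
      ≡⟨ cong (_% (m * N)) y≡v[gm] ⟨
    y % (m * N) ∎
    where
    open ≡-Reasoning
    expand : ∀ k′ g m w M R → k′ * g * (m * (w + M * R)) ≡ k′ * w * (g * m) + k′ * R * (m * (M * g))
    expand = solve-∀

-- Among u m, …, u m + m − 1 only u m can have gcd m with N m.
count-gcd-block : ∀ u N m .{{_ : NonZero m}} →
  sumBelow m (λ r → ⟦ does (gcd (u * m + r) (N * m) ≟ m) ⟧) ≡ ⟦ does (gcd u N ≟ 1) ⟧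
count-gcd-block u N m = trans (sumBelow-select m _ (n≢0⇒n>0 (≢-nonZero⁻¹ m)) off-zero) at-zero
  where
  gcd≡gcd*m : gcd (u * m + 0) (N * m) ≡ gcd u N * m
  gcd≡gcd*m = trans (cong (λ z → gcd z (N * m)) (+-identityʳ (u * m))) (gcd[am,bm]≡gcd[a,b]*m u N m)
  at-zero : ⟦ does (gcd (u * m + 0) (N * m) ≟ m) ⟧ ≡ ⟦ does (gcd u N ≟ 1) ⟧
  at-zero = cong ⟦_⟧ (does-⇔ (mk⇔
    (λ e → *-cancelʳ-≡ (gcd u N) 1 m (trans (sym gcd≡gcd*m) (trans e (sym (*-identityˡ m)))))
    (λ e → trans gcd≡gcd*m (trans (cong (_* m) e) (*-identityˡ m))))
    (gcd (u * m + 0) (N * m) ≟ m) (gcd u N ≟ 1))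
  off-zero : ∀ r → r < m → r ≢ 0 → ⟦ does (gcd (u * m + r) (N * m) ≟ m) ⟧ ≡ 0
  off-zero r r<m r≢0 = cong ⟦_⟧ (dec-false (gcd (u * m + r) (N * m) ≟ m) λ e →
    <⇒≱ r<m (∣⇒≤ {{≢-nonZero r≢0}} (∣m+n∣m⇒∣n (subst (_∣ u * m + r) e (gcd[m,n]∣m _ _)) (n∣m*n u))))

-- The classes A_m of ℤ/nℤ and the graph G

module _ (n k : ℕ) {{_ : NonZero n}} where

  gcdₙ : Fin n → ℕ
  gcdₙ x = gcd (toℕ x) n

  -- k · A_m = A_(kImage m) (gcdₙ-mulZ, mulZ-onto), so kImage is the parent map of G, and it
  -- fixes exactly the roots.
  kImage : ℕ → ℕ
  kImage m = gcd (k * m) n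

  gcdₙ∣n : ∀ x → gcdₙ x ∣ n
  gcdₙ∣n x = gcd[m,n]∣n (toℕ x) n

  kImage∣n : ∀ m → kImage m ∣ n
  kImage∣n m = gcd[m,n]∣n (k * m) n

  ∣n⇒≢0 : ∀ {m} → m ∣ n → m ≢ 0
  ∣n⇒≢0 m∣n refl = ≢-nonZero⁻¹ n (0∣⇒≡0 m∣n)

  m*[n/ᵈm]≡n : ∀ {m} → m ∣ n → m * (n /ᵈ m) ≡ n
  m*[n/ᵈm]≡n {zero} 0∣n = ⊥-elim (∣n⇒≢0 0∣n refl)
  m*[n/ᵈm]≡n {suc m} m∣n = m*[n/m]≡n m∣n

  toℕ-mulZ : ∀ x → toℕ (mulZ n k x) ≡ (k * toℕ x) % n
  toℕ-mulZ x = toℕ-fromℕ< (m%n<n (k * toℕ x) n)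

  gcdₙ-mulZ : ∀ x → gcdₙ (mulZ n k x) ≡ kImage (gcdₙ x)
  gcdₙ-mulZ x = begin
    gcd (toℕ (mulZ n k x)) n   ≡⟨ cong (λ z → gcd z n) (toℕ-mulZ x) ⟩
    gcd ((k * toℕ x) % n) n    ≡⟨ gcd[m%n,n]≡gcd[m,n] (k * toℕ x) n ⟩
    gcd (k * toℕ x) n          ≡⟨ gcd[km,n]≡gcd[k*gcd[m,n],n] k (toℕ x) n ⟩
    gcd (k * gcdₙ x) n         ∎
    where open ≡-Reasoning

  lookup-Adiv : ∀ m x → lookup (Adiv n m) x ≡ does (gcdₙ x ≟ m)
  lookup-Adiv m = lookup∘tabulate (λ x → does (gcdₙ x ≟ m))

  ∈Adiv⁻ : ∀ {m x} → x ∈ Adiv n m → gcdₙ x ≡ m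
  ∈Adiv⁻ {m} {x} x∈A = ≡ᵇ⇒≡ (gcdₙ x) m (subst T (lookup-Adiv m x) (∈⇒T-lookup x∈A))

  ∈Adiv⁺ : ∀ {m x} → gcdₙ x ≡ m → x ∈ Adiv n m
  ∈Adiv⁺ {m} {x} gcd≡m = T-lookup⇒∈ (subst T (sym (lookup-Adiv m x)) (≡⇒≡ᵇ (gcdₙ x) m gcd≡m))

  kImage≡gcd[k,n/m]*m : ∀ {m} → m ∣ n → kImage m ≡ gcd k (n /ᵈ m) * m
  kImage≡gcd[k,n/m]*m {m} m∣n = begin
    gcd (k * m) n                 ≡⟨ cong₂ gcd (*-comm k m) (sym (m*[n/ᵈm]≡n m∣n)) ⟩
    gcd (m * k) (m * (n /ᵈ m))   ≡⟨ c*gcd[m,n]≡gcd[cm,cn] m k (n /ᵈ m) ⟨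
    m * gcd k (n /ᵈ m)           ≡⟨ *-comm m _ ⟩
    gcd k (n /ᵈ m) * m           ∎
    where open ≡-Reasoning

  cop⇒kImage≡ : ∀ {m} → m ∣ n → T (cop n k m) → kImage m ≡ m
  cop⇒kImage≡ {m} m∣n c = trans (kImage≡gcd[k,n/m]*m m∣n)
    (trans (cong (_* m) (≡ᵇ⇒≡ (gcd k (n /ᵈ m)) 1 c)) (*-identityˡ m))

  ¬cop⇒<kImage : ∀ {m} → m ∣ n → ¬ T (cop n k m) → m < kImage m
  ¬cop⇒<kImage {m} m∣n ¬c = begin-strict
    m                   <⟨ m<m*n m g (≤∧≢⇒< (n≢0⇒n>0 g≢0) (≢-sym (¬c ∘ ≡⇒≡ᵇ g 1))) ⟩
    m * g               ≡⟨ *-comm m g ⟩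
    g * m               ≡⟨ kImage≡gcd[k,n/m]*m m∣n ⟨
    kImage m            ∎
    where
    open ≤-Reasoning
    instance
      m≢0 : NonZero m
      m≢0 = ≢-nonZero (∣n⇒≢0 m∣n)
    g = gcd k (n /ᵈ m)
    g≢0 : g ≢ 0
    g≢0 g≡0 = ≢-nonZero⁻¹ n (begin-equality
      n              ≡⟨ m*[n/ᵈm]≡n m∣n ⟨
      m * (n /ᵈ m)   ≡⟨ cong (m *_) (gcd[m,n]≡0⇒n≡0 k g≡0) ⟩
      m * 0          ≡⟨ *-zeroʳ m ⟩
      0              ∎)

  Adiv-nonempty : ∀ {m} → m ∣ n → ∃ λ x → gcdₙ x ≡ m
  Adiv-nonempty {m} m∣n = m mod n , (begin
    gcd (toℕ (m mod n)) n   ≡⟨ cong (λ z → gcd z n) (toℕ-fromℕ< (m%n<n m n)) ⟩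
    gcd (m % n) n           ≡⟨ gcd[m%n,n]≡gcd[m,n] m n ⟩
    gcd m n                 ≡⟨ gcd[m,n]≡m m∣n ⟩
    m                       ∎)
    where open ≡-Reasoning

  mulZ-onto : ∀ {m} → m ∣ n → ∀ y → gcdₙ y ≡ kImage m → ∃ λ x → gcdₙ x ≡ m × mulZ n k x ≡ y
  mulZ-onto {m} m∣n y gcd≡ =
    onto (k*-onto-gcd-class k m N mN≡n (toℕ y) (trans gcd≡ (kImage≡gcd[k,n/m]*m m∣n)))
    where
    N = n /ᵈ m
    mN≡n = m*[n/ᵈm]≡n m∣n
    onto : (∃ λ u → Coprime u N × (k * (m * u)) % n ≡ toℕ y % n) → ∃ λ x → gcdₙ x ≡ m × mulZ n k x ≡ y
    onto (u , u⊥N , k[mu]≡y) = (m * u) mod n , gcd≡m , toℕ-injective k·x≡y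
      where
      open ≡-Reasoning
      toℕ-x : toℕ ((m * u) mod n) ≡ (m * u) % n
      toℕ-x = toℕ-fromℕ< (m%n<n (m * u) n)
      gcd≡m : gcdₙ ((m * u) mod n) ≡ m
      gcd≡m = begin
        gcd (toℕ ((m * u) mod n)) n   ≡⟨ cong (λ z → gcd z n) toℕ-x ⟩
        gcd ((m * u) % n) n           ≡⟨ gcd[m%n,n]≡gcd[m,n] (m * u) n ⟩
        gcd (m * u) n                 ≡⟨ cong₂ gcd (*-comm m u) (trans (sym mN≡n) (*-comm m N)) ⟩
        gcd (u * m) (N * m)           ≡⟨ gcd[am,bm]≡gcd[a,b]*m u N m ⟩
        gcd u N * m                   ≡⟨ cong (_* m) (coprime⇒gcd≡1 u⊥N) ⟩
        1 * m                         ≡⟨ *-identityˡ m ⟩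
        m                             ∎
      k·x≡y : toℕ (mulZ n k ((m * u) mod n)) ≡ toℕ y
      k·x≡y = begin
        toℕ (mulZ n k ((m * u) mod n))  ≡⟨ toℕ-mulZ _ ⟩
        (k * toℕ ((m * u) mod n)) % n    ≡⟨ cong (λ z → (k * z) % n) toℕ-x ⟩
        (k * ((m * u) % n)) % n          ≡⟨ [m*[n%d]]%d≡[m*n]%d k (m * u) n ⟩
        (k * (m * u)) % n                ≡⟨ k[mu]≡y ⟩
        toℕ y % n                        ≡⟨ m<n⇒m%n≡m (toℕ<n y) ⟩
        toℕ y                            ∎

  count-Adiv : ∀ {m} → m ∣ n → count (λ x → does (gcdₙ x ≟ m)) ≡ φ (n /ᵈ m)
  count-Adiv {m} m∣n = begin
    sumBelow n (λ i → ⟦ does (gcd i n ≟ m) ⟧)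
      ≡⟨ cong (λ z → sumBelow z (λ i → ⟦ does (gcd i z ≟ m) ⟧)) Nm≡n ⟨
    sumBelow (N * m) (λ i → ⟦ does (gcd i (N * m) ≟ m) ⟧)
      ≡⟨ sumBelow-* N m (λ i → ⟦ does (gcd i (N * m) ≟ m) ⟧) ⟩
    sumBelow N (λ u → sumBelow m (λ r → ⟦ does (gcd (u * m + r) (N * m) ≟ m) ⟧))
      ≡⟨ sum-cong-≗ {N} (λ u → count-gcd-block (toℕ u) N m) ⟩
    sumBelow N (λ u → ⟦ does (gcd u N ≟ 1) ⟧)
      ≡⟨ length-filter-applyUpTo (λ i → gcd i N ≟ 1) (λ i → i) N ⟨
    φ N ∎
    where
    open ≡-Reasoning
    N = n /ᵈ m
    instance
      m≢0 : NonZero m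
      m≢0 = ≢-nonZero (∣n⇒≢0 m∣n)
    Nm≡n : N * m ≡ n
    Nm≡n = trans (*-comm N m) (m*[n/ᵈm]≡n m∣n)

  Edge⇒ : ∀ {m p} → Edge n k m p → m ∣ n × ¬ T (cop n k m) × p ≡ kImage m
  Edge⇒ {m} {p} (m∣n , _ , m<p , k·Aₘ≡Aₚ) = m∣n , ¬cop , p≡kImage
    where
    x = proj₁ (Adiv-nonempty m∣n)
    gcd[x]≡m = proj₂ (Adiv-nonempty m∣n)
    kx∈Aₚ : mulZ n k x ∈ Adiv n p
    kx∈Aₚ = Equivalence.from (k·Aₘ≡Aₚ (mulZ n k x)) (x , ∈Adiv⁺ gcd[x]≡m , refl)
    p≡kImage : p ≡ kImage m
    p≡kImage = begin
      p                   ≡⟨ ∈Adiv⁻ kx∈Aₚ ⟨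
      gcdₙ (mulZ n k x)   ≡⟨ gcdₙ-mulZ x ⟩
      kImage (gcdₙ x)     ≡⟨ cong kImage gcd[x]≡m ⟩
      kImage m            ∎
      where open ≡-Reasoning
    ¬cop : ¬ T (cop n k m)
    ¬cop c = <-irrefl (sym (trans p≡kImage (cop⇒kImage≡ m∣n c))) m<p

  Edge⁺ : ∀ {m} → m ∣ n → ¬ T (cop n k m) → Edge n k m (kImage m)
  Edge⁺ {m} m∣n ¬c = m∣n , kImage∣n m , ¬cop⇒<kImage m∣n ¬c , λ y → mk⇔ (image⇒ y) (⇒image y)
    where
    image⇒ : ∀ y → y ∈ Adiv n (kImage m) → ∃ λ x → x ∈ Adiv n m × mulZ n k x ≡ y
    image⇒ y y∈A with x , gcd[x]≡m , kx≡y ← mulZ-onto m∣n y (∈Adiv⁻ y∈A) = x , ∈Adiv⁺ gcd[x]≡m , kx≡y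
    ⇒image : ∀ y → (∃ λ x → x ∈ Adiv n m × mulZ n k x ≡ y) → y ∈ Adiv n (kImage m)
    ⇒image _ (x , x∈A , refl) = ∈Adiv⁺ (trans (gcdₙ-mulZ x) (cong kImage (∈Adiv⁻ x∈A)))

  cop⇒IsRoot : ∀ {r} → r ∣ n → T (cop n k r) → IsRoot n k r
  cop⇒IsRoot r∣n c = r∣n , λ p e → proj₁ (proj₂ (Edge⇒ e)) c

  IsRoot⇒cop : ∀ {r} → IsRoot n k r → T (cop n k r)
  IsRoot⇒cop {r} (r∣n , noParent) with T? (cop n k r)
  ... | yes c = c
  ... | no ¬c = contradiction (Edge⁺ r∣n ¬c) (noParent (kImage r))

  InTree⇒∣ : ∀ {r m l} → InTree n k r m l → m ∣ n
  InTree⇒∣ (root (r∣n , _)) = r∣n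
  InTree⇒∣ (child e _) = proj₁ e

  InTree⇒root∣ : ∀ {r m l} → InTree n k r m l → r ∣ n
  InTree⇒root∣ (root (r∣n , _)) = r∣n
  InTree⇒root∣ (child _ t) = InTree⇒root∣ t

  InTree-level+vertex≤ : ∀ {r m l} → InTree n k r m l → m + l ≤ suc r
  InTree-level+vertex≤ {r} (root _) = ≤-reflexive (+-comm r 1)
  InTree-level+vertex≤ {m = m} (child {l = l} (_ , _ , m<p , _) t) =
    ≤-trans (≤-reflexive (+-suc m l)) (≤-trans (+-monoˡ-≤ l m<p) (InTree-level+vertex≤ t))

  InTree-level≤ : ∀ {r m l} → InTree n k r m l → l ≤ suc n
  InTree-level≤ t = ≤-trans (m≤n+m _ _) (≤-trans (InTree-level+vertex≤ t) (s≤s (∣⇒≤ (InTree⇒root∣ t))))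

  InTree? : ∀ r m l → Dec (InTree n k r m l)
  InTree? r m zero = no λ ()
  InTree? r m (suc zero) with m ≟ r | r ∣? n | T? (cop n k m)
  ... | no m≢r | _ | _ = no λ { (root _) → m≢r refl ; (child _ ()) }
  ... | yes refl | no r∤n | _ = no λ { (root (r∣n , _)) → r∤n r∣n ; (child _ ()) }
  ... | yes refl | yes r∣n | yes c = yes (root (cop⇒IsRoot r∣n c))
  ... | yes refl | yes r∣n | no ¬c = no λ { (root isRoot) → ¬c (IsRoot⇒cop isRoot) ; (child _ ()) }
  InTree? r m (suc (suc l)) with m ∣? n | T? (cop n k m) | InTree? r (kImage m) (suc l)
  ... | no m∤n | _ | _ = no λ { (child e _) → m∤n (proj₁ e) }
  ... | yes m∣n | yes c | _ = no λ { (child e _) → proj₁ (proj₂ (Edge⇒ e)) c }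
  ... | yes m∣n | no ¬c | yes t = yes (child (Edge⁺ m∣n ¬c) t)
  ... | yes m∣n | no ¬c | no ¬t =
    no λ { (child e t) → ¬t (subst (λ p → InTree n k r p (suc l)) (proj₂ (proj₂ (Edge⇒ e))) t) }

  inSomeTree : ∀ {m} → m ∣ n → ∃ λ r → ∃ λ l → InTree n k r m l
  inSomeTree m∣n = climb _ ≤-refl m∣n
    where
    climb : ∀ j {m} → n ∸ m ≤ j → m ∣ n → ∃ λ r → ∃ λ l → InTree n k r m l
    climb j {m} n∸m≤j m∣n with T? (cop n k m)
    ... | yes c = m , 1 , root (cop⇒IsRoot m∣n c)
    ... | no ¬c with j | ≤-trans (∸-monoʳ-< (¬cop⇒<kImage m∣n ¬c) (∣⇒≤ (kImage∣n m))) n∸m≤j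
    ...   | zero | ()
    ...   | suc j | s≤s bound with r , l , t ← climb j bound (kImage∣n m)
      = r , suc l , child (Edge⁺ m∣n ¬c) t

  level-occupied? : ∀ r l → Dec (∃ λ m → m < suc n × InTree n k r m l)
  level-occupied? r l = anyUpTo? (λ m → InTree? r m l) (suc n)

  InTree⇒occupied : ∀ {r m l} → InTree n k r m l → ∃ λ m → m < suc n × InTree n k r m l
  InTree⇒occupied {m = m} t = m , s≤s (∣⇒≤ (InTree⇒∣ t)) , t

  maxLevel-exists : ∀ {r m l} → InTree n k r m l → ∃ λ L → MaxLevel n k r L
  maxLevel-exists {r} t
    with L , (_ , _ , t′) , maximal ←
           bounded-max (level-occupied? r) (suc n) (InTree-level≤ t) (InTree⇒occupied t)
    = L , (_ , t′) , λ _ l′ t″ → maximal l′ (InTree-level≤ t″) (InTree⇒occupied t″)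

  record Position (m : ℕ) : Set where
    field
      treeRoot height level : ℕ
      inTree : InTree n k treeRoot m level
      maxLevel : MaxLevel n k treeRoot height

  position : ∀ {m} → m ∣ n → Position m
  position m∣n with r , l , t ← inSomeTree m∣n with L , maxL ← maxLevel-exists t
    = record { treeRoot = r ; height = L ; level = l ; inTree = t ; maxLevel = maxL }

  -- Sums over the divisors of n

  ⟦_∣n⟧ : ℕ → ℕ
  ⟦ d ∣n⟧ = ⟦ does (d ∣? n) ⟧

  divisorSum : (ℕ → ℕ) → ℕ
  divisorSum f = sumBelow (suc n) (λ d → ⟦ d ∣n⟧ * f d)

  ⟦∣n⟧≡1 : ∀ {d} → d ∣ n → ⟦ d ∣n⟧ ≡ 1
  ⟦∣n⟧≡1 {d} d∣n = cong ⟦_⟧ (dec-true (d ∣? n) d∣n)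

  divisorSum-cong : ∀ {f g} → (∀ d → d ∣ n → f d ≡ g d) → divisorSum f ≡ divisorSum g
  divisorSum-cong {f} {g} f≡g = sum-cong-≗ {suc n} (termwise ∘ toℕ)
    where
    termwise : ∀ d → ⟦ does (d ∣? n) ⟧ * f d ≡ ⟦ does (d ∣? n) ⟧ * g d
    termwise d with d ∣? n
    ... | yes d∣n = cong (1 *_) (f≡g d d∣n)
    ... | no _ = refl

  divisorSum-mono-≤ : ∀ {f g} → (∀ d → d ∣ n → f d ≤ g d) → divisorSum f ≤ divisorSum g
  divisorSum-mono-≤ {f} {g} f≤g = sum-mono-≤ {suc n} {λ i → ⟦ toℕ i ∣n⟧ * f (toℕ i)} (termwise ∘ toℕ)
    where
    termwise : ∀ d → ⟦ does (d ∣? n) ⟧ * f d ≤ ⟦ does (d ∣? n) ⟧ * g d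
    termwise d with d ∣? n
    ... | yes d∣n = *-monoʳ-≤ 1 (f≤g d d∣n)
    ... | no _ = z≤n

  divisorSum-+ : ∀ f g → divisorSum (λ d → f d + g d) ≡ divisorSum f + divisorSum g
  divisorSum-+ f g =
    trans (sum-cong-≗ {suc n} λ i → *-distribˡ-+ ⟦ toℕ i ∣n⟧ (f (toℕ i)) (g (toℕ i)))
          (∑-distrib-+ {suc n} (λ i → ⟦ toℕ i ∣n⟧ * f (toℕ i)) (λ i → ⟦ toℕ i ∣n⟧ * g (toℕ i)))

  term≤divisorSum : ∀ f {d} → d ∣ n → f d ≤ divisorSum f
  term≤divisorSum f {d} d∣n = begin
    f d            ≡⟨ *-identityˡ (f d) ⟨
    1 * f d        ≡⟨ cong (_* f d) (⟦∣n⟧≡1 d∣n) ⟨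
    ⟦ d ∣n⟧ * f d  ≤⟨ term≤sumBelow (suc n) (λ d → ⟦ d ∣n⟧ * f d) (s≤s (∣⇒≤ d∣n)) ⟩
    divisorSum f   ∎
    where open ≤-Reasoning

  divisorSum-select : ∀ f {c} → c ∣ n → (∀ d → d ∣ n → d ≢ c → f d ≡ 0) → divisorSum f ≡ f c
  divisorSum-select f {c} c∣n f≡0 = trans (sumBelow-select (suc n) _ (s≤s (∣⇒≤ c∣n)) off-c)
    (trans (cong (_* f c) (⟦∣n⟧≡1 c∣n)) (*-identityˡ (f c)))
    where
    off-c : ∀ d → d < suc n → d ≢ c → ⟦ does (d ∣? n) ⟧ * f d ≡ 0
    off-c d _ d≢c with d ∣? n
    ... | yes d∣n = cong (1 *_) (f≡0 d d∣n d≢c)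
    ... | no _ = refl

  sumBelow≡divisorSum : ∀ f → (∀ d → ¬ d ∣ n → f d ≡ 0) → sumBelow (suc n) f ≡ divisorSum f
  sumBelow≡divisorSum f f≡0 = sum-cong-≗ {suc n} λ i → termwise (toℕ i)
    where
    termwise : ∀ d → f d ≡ ⟦ does (d ∣? n) ⟧ * f d
    termwise d with d ∣? n
    ... | yes _ = sym (*-identityˡ (f d))
    ... | no d∤n = f≡0 d d∤n

  divisorSum-comm : ∀ (F : ℕ → ℕ → ℕ) →
    divisorSum (λ d → divisorSum (F d)) ≡ divisorSum (λ c → divisorSum (λ d → F d c))
  divisorSum-comm F = begin
    sumBelow (suc n) (λ d → ⟦ d ∣n⟧ * sumBelow (suc n) (λ c → ⟦ c ∣n⟧ * F d c))
      ≡⟨ sum-cong-≗ {suc n} (λ d → distrib ⟦ toℕ d ∣n⟧ (λ c → ⟦ c ∣n⟧ * F (toℕ d) c)) ⟩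
    sumBelow (suc n) (λ d → sumBelow (suc n) (λ c → ⟦ d ∣n⟧ * (⟦ c ∣n⟧ * F d c)))
      ≡⟨ ∑-comm {suc n} {suc n} (λ d c → ⟦ toℕ d ∣n⟧ * (⟦ toℕ c ∣n⟧ * F (toℕ d) (toℕ c))) ⟩
    sumBelow (suc n) (λ c → sumBelow (suc n) (λ d → ⟦ d ∣n⟧ * (⟦ c ∣n⟧ * F d c)))
      ≡⟨ sum-cong-≗ {suc n} (λ c → sum-cong-≗ {suc n} λ d →
           x∙yz≈y∙xz ⟦ toℕ d ∣n⟧ ⟦ toℕ c ∣n⟧ (F (toℕ d) (toℕ c))) ⟩
    sumBelow (suc n) (λ c → sumBelow (suc n) (λ d → ⟦ c ∣n⟧ * (⟦ d ∣n⟧ * F d c)))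
      ≡⟨ sum-cong-≗ {suc n} (λ c → distrib ⟦ toℕ c ∣n⟧ (λ d → ⟦ d ∣n⟧ * F d (toℕ c))) ⟨
    sumBelow (suc n) (λ c → ⟦ c ∣n⟧ * sumBelow (suc n) (λ d → ⟦ d ∣n⟧ * F d c)) ∎
    where
    open ≡-Reasoning
    distrib : ∀ x (f : ℕ → ℕ) → x * sumBelow (suc n) f ≡ sumBelow (suc n) (λ d → x * f d)
    distrib x f = *-distribˡ-sum {suc n} x (f ∘ toℕ)

  countIn : ℕ → (Fin n → Bool) → ℕ
  countIn d P = count (λ x → does (gcdₙ x ≟ d) ∧ P x)

  count-by-gcdₙ : ∀ P → count P ≡ divisorSum (λ d → countIn d P)
  count-by-gcdₙ P = begin
    count P
      ≡⟨ sum-cong-≗ {n} (λ x → sym (select-class x)) ⟩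
    ∑[ x < n ] sumBelow (suc n) (λ d → ⟦ does (gcdₙ x ≟ d) ∧ P x ⟧)
      ≡⟨ ∑-comm {n} {suc n} (λ x d → ⟦ does (gcdₙ x ≟ toℕ d) ∧ P x ⟧) ⟩
    sumBelow (suc n) (λ d → count (λ x → does (gcdₙ x ≟ d) ∧ P x))
      ≡⟨ sumBelow≡divisorSum _ empty-class ⟩
    divisorSum (λ d → count (λ x → does (gcdₙ x ≟ d) ∧ P x)) ∎
    where
    open ≡-Reasoning
    empty-class : ∀ d → ¬ d ∣ n → count (λ x → does (gcdₙ x ≟ d) ∧ P x) ≡ 0
    empty-class d d∤n = trans (sum-cong-≗ {n} λ x → cong (λ b → ⟦ b ∧ P x ⟧)
      (dec-false (gcdₙ x ≟ d) λ gcd≡d → d∤n (subst (_∣ n) gcd≡d (gcdₙ∣n x)))) (sum-replicate-zero n)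
    select-class : ∀ x → sumBelow (suc n) (λ d → ⟦ does (gcdₙ x ≟ d) ∧ P x ⟧) ≡ ⟦ P x ⟧
    select-class x = trans (sumBelow-select (suc n) _ (s≤s (∣⇒≤ (gcdₙ∣n x))) off-class)
                           (cong (λ b → ⟦ b ∧ P x ⟧) (dec-true (gcdₙ x ≟ gcdₙ x) refl))
      where
      off-class : ∀ d → d < suc n → d ≢ gcdₙ x → ⟦ does (gcdₙ x ≟ d) ∧ P x ⟧ ≡ 0
      off-class d _ d≢gcd = cong (λ b → ⟦ b ∧ P x ⟧) (dec-false (gcdₙ x ≟ d) (d≢gcd ∘ sym))

  ∈-divisors⁺ : ∀ {m} → m ∣ n → m ∈ₗ divisors n
  ∈-divisors⁺ {zero} 0∣n = contradiction refl (∣n⇒≢0 0∣n)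
  ∈-divisors⁺ {suc m} m∣n = ∈-filter⁺ (_∣? n) (∈-applyUpTo⁺ suc (∣⇒≤ m∣n)) m∣n

  ∈-divisors⁻ : ∀ {m} → m ∈ₗ divisors n → m ∣ n
  ∈-divisors⁻ m∈ = proj₂ (∈-filter⁻ (_∣? n) {xs = applyUpTo suc n} m∈)

  sum-filter-divisors : ∀ (P : ℕ → Bool) (g : ℕ → ℕ) →
    ListAction.sum (map g (filter (λ m → T? (P m)) (divisors n))) ≡ divisorSum (λ d → ⟦ P d ⟧ * g d)
  sum-filter-divisors P g = begin
    ListAction.sum (map g (filter (λ m → T? (P m)) (divisors n)))
      ≡⟨ sum-map-filter (λ m → T? (P m)) g (divisors n) ⟩
    ListAction.sum (map (λ d → ⟦ P d ⟧ * g d) (divisors n))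
      ≡⟨ sum-map-filter (_∣? n) _ (applyUpTo suc n) ⟩
    ListAction.sum (map h (applyUpTo suc n))
      ≡⟨ sum-map-applyUpTo h suc n ⟩
    sumBelow n (h ∘ suc)
      ≡⟨ cong (λ b → ⟦ b ⟧ * (⟦ P 0 ⟧ * g 0) + sumBelow n (h ∘ suc)) (dec-false (0 ∣? n) 0∤n) ⟨
    divisorSum (λ d → ⟦ P d ⟧ * g d) ∎
    where
    open ≡-Reasoning
    h : ℕ → ℕ
    h d = ⟦ d ∣n⟧ * (⟦ P d ⟧ * g d)
    0∤n : ¬ 0 ∣ n
    0∤n 0∣n = ∣n⇒≢0 0∣n refl

  sumNonCop+sumCop≡ : ∀ B → sumNonCop n k B + sumCop n k B ≡ divisorSum (λ d → ⟦ B d ⟧ * α n k d)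
  sumNonCop+sumCop≡ B = begin
    sumNonCop n k B + sumCop n k B
      ≡⟨ cong₂ _+_ (sum-filter-divisors (λ d → B d ∧ not (cop n k d)) φₙ)
                   (sum-filter-divisors (λ d → B d ∧ cop n k d) Rₙ) ⟩
    divisorSum nonCopTerm + divisorSum copTerm
      ≡⟨ divisorSum-+ nonCopTerm copTerm ⟨
    divisorSum (λ d → nonCopTerm d + copTerm d)
      ≡⟨ divisorSum-cong (λ d _ → ⟦b⟧*if-split (B d) (cop n k d) (φₙ d) (Rₙ d)) ⟨
    divisorSum (λ d → ⟦ B d ⟧ * α n k d) ∎
    where
    open ≡-Reasoning
    φₙ Rₙ nonCopTerm copTerm : ℕ → ℕ
    φₙ d = φ (n /ᵈ d)
    Rₙ d = RkSet n k (Adiv n d)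
    nonCopTerm d = ⟦ B d ∧ not (cop n k d) ⟧ * φₙ d
    copTerm d = ⟦ B d ∧ cop n k d ⟧ * Rₙ d

  RkSet-lower : ∀ {A S} → S ⊆ A → KFree n k S → ∣ S ∣ ≤ RkSet n k A
  RkSet-lower {A} {S} S⊆A kfree = foldr-preservesᵒ ≤⊔ 0 _ (inj₂ (Any.map⁺ (lose S∈ ≤-refl)))
    where
    S∈ = ∈-filter⁺ (λ S → (S ⊆? A) ×-dec kfree? n k S) (allSubsets-complete S) (S⊆A , kfree)
    ≤⊔ : ∀ x y → ∣ S ∣ ≤ x ⊎ ∣ S ∣ ≤ y → ∣ S ∣ ≤ x ⊔ y
    ≤⊔ x y (inj₁ ≤x) = ≤-trans ≤x (m≤m⊔n x y)
    ≤⊔ x y (inj₂ ≤y) = ≤-trans ≤y (m≤n⊔m x y)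

  RkSet-upper : ∀ {A b} → (∀ S → S ⊆ A → KFree n k S → ∣ S ∣ ≤ b) → RkSet n k A ≤ b
  RkSet-upper {A} {b} bound =
    foldr-preservesᵇ {P = _≤ b} ⊔-lub z≤n (All.map⁺ {f = ∣_∣} (All.tabulate λ {S} S∈ →
      let S⊆A , kfree = proj₂ (∈-filter⁻ (λ S → (S ⊆? A) ×-dec kfree? n k S) {xs = allSubsets n} S∈)
      in bound S S⊆A kfree))

  ChildIn : (ℕ → Bool) → ℕ → ℕ → Set
  ChildIn B m c = c ∣ n × ¬ T (cop n k c) × kImage c ≡ m × T (B c)

  childIn? : ∀ B m c → Dec (ChildIn B m c)
  childIn? B m c = (c ∣? n) ×-dec ¬? (T? (cop n k c)) ×-dec (kImage c ≟ m) ×-dec T? (B c)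

  module _ (B : ℕ → Bool) (procedure : IsProcedureSet n k B) where

    kImage∉B : ∀ {m} → m ∣ n → ¬ T (cop n k m) → T (B m) → ¬ T (B (kImage m))
    kImage∉B {m} m∣n ¬c Bm Bp =
      [ (λ level≡height → <-irrefl level≡height (proj₂ maxLevel m _ (child edge inTree)))
      , (λ (_ , _ , noChildInB) → noChildInB m edge Bm)
      ]′ (Equivalence.to (procedure _ treeRoot level height (kImage∣n m) inTree maxLevel) Bp)
      where
      open Position (position (kImage∣n m))
      edge = Edge⁺ m∣n ¬c

    ∉B⇒ : ∀ {m} → m ∣ n → ¬ T (B m) → α n k m ≡ 0 ⊎ ∃ (ChildIn B m)
    ∉B⇒ {m} m∣n ¬Bm with α n k m ≟ 0 | anyUpTo? (childIn? B m) (suc n)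
    ... | yes α≡0 | _ = inj₁ α≡0
    ... | no _ | yes (c , _ , c∈B) = inj₂ (c , c∈B)
    ... | no α≢0 | no noChildInB = contradiction (B⇐ (inj₂ (level<height , α≢0 , noChild))) ¬Bm
      where
      open Position (position m∣n)
      B⇐ = Equivalence.from (procedure m treeRoot level height m∣n inTree maxLevel)
      level<height : level < height
      level<height = ≤∧≢⇒< (proj₂ maxLevel m level inTree) (¬Bm ∘ B⇐ ∘ inj₁)
      noChild : ∀ c → Edge n k c m → ¬ T (B c)
      noChild c e Bc with c∣n , ¬cop , m≡kImage ← Edge⇒ e =
        noChildInB (c , s≤s (∣⇒≤ c∣n) , c∣n , ¬cop , sym m≡kImage , Bc)

    -- The bound for k-free sets

    module _ (S : Subset n) (kfree : KFree n k S) where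

      S∩A : ℕ → Subset n
      S∩A d = tabulate (λ x → does (gcdₙ x ≟ d) ∧ lookup S x)

      ∣S∩A∣ : ℕ → ℕ
      ∣S∩A∣ d = countIn d (lookup S)

      ∣A∖S∣ : ℕ → ℕ
      ∣A∖S∣ d = countIn d (not ∘ lookup S)

      ∣S∣≡divisorSum : ∣ S ∣ ≡ divisorSum ∣S∩A∣
      ∣S∣≡divisorSum = trans (∣p∣≡count S) (count-by-gcdₙ (lookup S))

      ∣S∩A∣≤φ : ∀ {d} → d ∣ n → ∣S∩A∣ d ≤ φ (n /ᵈ d)
      ∣S∩A∣≤φ {d} d∣n = ≤-trans (sum-mono-≤ λ x → ⟦∧⟧≤⟦⟧ (does (gcdₙ x ≟ d)) (lookup S x))
                                (≤-reflexive (count-Adiv d∣n))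

      ∣S∩A∣≤Rk : ∀ d → ∣S∩A∣ d ≤ RkSet n k (Adiv n d)
      ∣S∩A∣≤Rk d = subst (_≤ RkSet n k (Adiv n d)) ∣S∩A∣≡count (RkSet-lower S∩A⊆A S∩A-kfree)
        where
        S∩A⁻ : ∀ {x} → x ∈ S∩A d → gcdₙ x ≡ d × x ∈ S
        S∩A⁻ {x} x∈ with t ← Equivalence.to T-∧ (subst T (lookup∘tabulate _ x) (∈⇒T-lookup x∈)) =
          ≡ᵇ⇒≡ (gcdₙ x) d (proj₁ t) , T-lookup⇒∈ (proj₂ t)
        S∩A⊆A : S∩A d ⊆ Adiv n d
        S∩A⊆A = ∈Adiv⁺ ∘ proj₁ ∘ S∩A⁻
        S∩A-kfree : KFree n k (S∩A d)
        S∩A-kfree x x∈ kx∈ = kfree x (proj₂ (S∩A⁻ x∈)) (proj₂ (S∩A⁻ kx∈))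
        ∣S∩A∣≡count : ∣ S∩A d ∣ ≡ ∣S∩A∣ d
        ∣S∩A∣≡count = trans (∣p∣≡count (S∩A d)) (sum-cong-≗ {n} (cong ⟦_⟧ ∘ lookup∘tabulate _))

      ∣S∩A∣≤α : ∀ {d} → d ∣ n → ∣S∩A∣ d ≤ α n k d
      ∣S∩A∣≤α {d} d∣n with cop n k d
      ... | true = ∣S∩A∣≤Rk d
      ... | false = ∣S∩A∣≤φ d∣n

      ∣S∩A[kImage]∣≤∣A∖S∣ : ∀ {c} → c ∣ n → ∣S∩A∣ (kImage c) ≤ ∣A∖S∣ c
      ∣S∩A[kImage]∣≤∣A∖S∣ {c} c∣n = count-surjection _ _ (mulZ n k) preimage
        where
        preimage : ∀ y → T (does (gcdₙ y ≟ kImage c) ∧ lookup S y) →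
          ∃ λ x → T (does (gcdₙ x ≟ c) ∧ not (lookup S x)) × mulZ n k x ≡ y
        preimage y t with gcd[y]≡ , y∈S ← Equivalence.to T-∧ t
                     with x , gcd[x]≡c , refl ← mulZ-onto c∣n y (≡ᵇ⇒≡ _ _ gcd[y]≡) =
          x , Equivalence.from T-∧ (≡⇒≡ᵇ _ _ gcd[x]≡c , x∉S) , refl
          where
          x∉S : T (not (lookup S x))
          x∉S = ¬T⇒T-not λ x∈S → kfree x (T-lookup⇒∈ x∈S) (T-lookup⇒∈ y∈S)

      ∣S∩A[kImage]∣≤φ∸∣S∩A∣ : ∀ {c} → c ∣ n → ∣S∩A∣ (kImage c) ≤ φ (n /ᵈ c) ∸ ∣S∩A∣ c
      ∣S∩A[kImage]∣≤φ∸∣S∩A∣ {c} c∣n = m+n≤o⇒m≤o∸n (∣S∩A∣ (kImage c)) (begin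
        ∣S∩A∣ (kImage c) + ∣S∩A∣ c   ≤⟨ +-monoˡ-≤ (∣S∩A∣ c) (∣S∩A[kImage]∣≤∣A∖S∣ c∣n) ⟩
        ∣A∖S∣ c + ∣S∩A∣ c            ≡⟨ +-comm (∣A∖S∣ c) (∣S∩A∣ c) ⟩
        ∣S∩A∣ c + ∣A∖S∣ c            ≡⟨ count-split _ (lookup S) ⟨
        count (λ x → does (gcdₙ x ≟ c)) ≡⟨ count-Adiv c∣n ⟩
        φ (n /ᵈ c)                  ∎)
        where open ≤-Reasoning

      -- leftover c is the room left in A_c for the charge of the parent of c ∈ B.
      leftover : ℕ → ℕ
      leftover c = ⟦ B c ∧ not (cop n k c) ⟧ * (φ (n /ᵈ c) ∸ ∣S∩A∣ c)

      charged : ℕ → ℕ → ℕ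
      charged d c = ⟦ does (kImage c ≟ d) ⟧ * leftover c

      charged-parent : ∀ c → charged (kImage c) c ≡ leftover c
      charged-parent c = trans (cong (λ b → ⟦ b ⟧ * leftover c) (dec-true (kImage c ≟ kImage c) refl))
                               (*-identityˡ (leftover c))

      charged-other : ∀ c d → d ≢ kImage c → charged d c ≡ 0
      charged-other c d d≢kImage =
        cong (λ b → ⟦ b ⟧ * leftover c) (dec-false (kImage c ≟ d) (d≢kImage ∘ sym))

      charge : ∀ {d} → d ∣ n → ∣S∩A∣ d ≤ ⟦ B d ⟧ * ∣S∩A∣ d + divisorSum (charged d)
      charge {d} d∣n with T? (B d)
      ... | yes Bd = begin
        ∣S∩A∣ d                                         ≡⟨ *-identityˡ (∣S∩A∣ d) ⟨
        1 * ∣S∩A∣ d                                     ≡⟨ cong (_* ∣S∩A∣ d) (⟦T⟧ Bd) ⟨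
        ⟦ B d ⟧ * ∣S∩A∣ d                               ≤⟨ m≤m+n _ (divisorSum (charged d)) ⟩
        ⟦ B d ⟧ * ∣S∩A∣ d + divisorSum (charged d)      ∎
        where open ≤-Reasoning
      ... | no ¬Bd with ∉B⇒ d∣n ¬Bd
      ...   | inj₁ α≡0 = ≤-trans (≤-trans (∣S∩A∣≤α d∣n) (≤-reflexive α≡0)) z≤n
      ...   | inj₂ (c , c∣n , ¬cop , refl , Bc) = begin
        ∣S∩A∣ (kImage c)                  ≤⟨ ∣S∩A[kImage]∣≤φ∸∣S∩A∣ c∣n ⟩
        φ (n /ᵈ c) ∸ ∣S∩A∣ c              ≡⟨ *-identityˡ _ ⟨
        1 * (φ (n /ᵈ c) ∸ ∣S∩A∣ c)        ≡⟨ cong (_* (φ (n /ᵈ c) ∸ ∣S∩A∣ c)) ⟦c∈B∖roots⟧≡1 ⟨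
        leftover c                        ≡⟨ charged-parent c ⟨
        charged (kImage c) c              ≤⟨ term≤divisorSum (charged (kImage c)) c∣n ⟩
        divisorSum (charged (kImage c))   ≤⟨ m≤n+m _ (⟦ B (kImage c) ⟧ * ∣S∩A∣ (kImage c)) ⟩
        ⟦ B (kImage c) ⟧ * ∣S∩A∣ (kImage c) + divisorSum (charged (kImage c)) ∎
        where
        open ≤-Reasoning
        ⟦c∈B∖roots⟧≡1 : ⟦ B c ∧ not (cop n k c) ⟧ ≡ 1
        ⟦c∈B∖roots⟧≡1 = ⟦T⟧ (Equivalence.from T-∧ (Bc , ¬T⇒T-not ¬cop))

      discharge : ∀ {d} → d ∣ n → ⟦ B d ⟧ * ∣S∩A∣ d + leftover d ≤ ⟦ B d ⟧ * α n k d
      discharge {d} d∣n = ⟦b⟧*w+leftover≤ (B d) (cop n k d) (λ _ → ∣S∩A∣≤Rk d) (λ _ → ∣S∩A∣≤φ d∣n)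

      divisorSum-charged : divisorSum (λ d → divisorSum (charged d)) ≡ divisorSum leftover
      divisorSum-charged = trans (divisorSum-comm charged) (divisorSum-cong λ c _ →
        trans (divisorSum-select (λ d → charged d c) (kImage∣n c) (λ d _ → charged-other c d))
              (charged-parent c))

      kFree-bound : ∣ S ∣ ≤ divisorSum (λ d → ⟦ B d ⟧ * α n k d)
      kFree-bound = begin
        ∣ S ∣
          ≡⟨ ∣S∣≡divisorSum ⟩
        divisorSum ∣S∩A∣
          ≤⟨ divisorSum-mono-≤ (λ d → charge) ⟩
        divisorSum (λ d → ⟦ B d ⟧ * ∣S∩A∣ d + divisorSum (charged d))
          ≡⟨ divisorSum-+ (λ d → ⟦ B d ⟧ * ∣S∩A∣ d) (λ d → divisorSum (charged d)) ⟩
        divisorSum (λ d → ⟦ B d ⟧ * ∣S∩A∣ d) + divisorSum (λ d → divisorSum (charged d))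
          ≡⟨ cong (divisorSum (λ d → ⟦ B d ⟧ * ∣S∩A∣ d) +_) divisorSum-charged ⟩
        divisorSum (λ d → ⟦ B d ⟧ * ∣S∩A∣ d) + divisorSum leftover
          ≡⟨ divisorSum-+ (λ d → ⟦ B d ⟧ * ∣S∩A∣ d) leftover ⟨
        divisorSum (λ d → ⟦ B d ⟧ * ∣S∩A∣ d + leftover d)
          ≤⟨ divisorSum-mono-≤ (λ d → discharge) ⟩
        divisorSum (λ d → ⟦ B d ⟧ * α n k d) ∎
        where open ≤-Reasoning

    -- The set B̄

    module _ (K : ℕ → Subset n)
             (K-max : ∀ m → m ∣ n → T (B m) → T (cop n k m) → IsMaxKFreeIn n k (Adiv n m) (K m)) where

      B̄ : Subset n
      B̄ = Bbar n k B K

      piece : ℕ → Fin n → Bool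
      piece m x = if cop n k m then lookup (K m) x else lookup (Adiv n m) x

      piece⇒gcdₙ : ∀ {m x} → m ∣ n → T (B m) → T (piece m x) → gcdₙ x ≡ m
      piece⇒gcdₙ {m} {x} m∣n Bm with cop n k m in c
      ... | true = λ x∈K → ∈Adiv⁻ (proj₁ (K-max m m∣n Bm (subst T (sym c) _)) (T-lookup⇒∈ x∈K))
      ... | false = λ x∈A → ∈Adiv⁻ (T-lookup⇒∈ x∈A)

      piece-cop⇒∈K : ∀ {m x} → T (cop n k m) → T (piece m x) → x ∈ K m
      piece-cop⇒∈K {m} _ with cop n k m
      ... | true = T-lookup⇒∈

      lookup-B̄ : ∀ x → lookup B̄ x ≡ B (gcdₙ x) ∧ piece (gcdₙ x) x
      lookup-B̄ x = trans (lookup∘tabulate _ x) (T-ext ⇒own-class ⇐own-class)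
        where
        q : ℕ → Bool
        q m = B m ∧ piece m x
        ⇒own-class : T (any q (divisors n)) → T (q (gcdₙ x))
        ⇒own-class t with m , m∈ , qm ← find (any⁻ q (divisors n) t)
                     with Bm , pm ← Equivalence.to T-∧ qm
          = subst (T ∘ q) (sym (piece⇒gcdₙ (∈-divisors⁻ m∈) Bm pm)) qm
        ⇐own-class : T (q (gcdₙ x)) → T (any q (divisors n))
        ⇐own-class t = any⁺ q (lose (∈-divisors⁺ (gcdₙ∣n x)) t)

      ∈B̄⁻ : ∀ {x} → x ∈ B̄ → T (B (gcdₙ x)) × T (piece (gcdₙ x) x)
      ∈B̄⁻ {x} x∈ = Equivalence.to T-∧ (subst T (lookup-B̄ x) (∈⇒T-lookup x∈))

      B̄-kfree : KFree n k B̄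
      B̄-kfree x x∈ kx∈ with Bm , x∈piece ← ∈B̄⁻ x∈ with Bkm , kx∈piece ← ∈B̄⁻ kx∈
                       with T? (cop n k (gcdₙ x))
      ... | no ¬coprime = kImage∉B (gcdₙ∣n x) ¬coprime Bm (subst (T ∘ B) (gcdₙ-mulZ x) Bkm)
      ... | yes coprime = K-kfree x (piece-cop⇒∈K coprime x∈piece) (piece-cop⇒∈K coprime kx∈pieceₘ)
        where
        m = gcdₙ x
        K-kfree = proj₁ (proj₂ (K-max m (gcdₙ∣n x) Bm coprime))
        gcd[kx]≡m : gcdₙ (mulZ n k x) ≡ m
        gcd[kx]≡m = trans (gcdₙ-mulZ x) (cop⇒kImage≡ (gcdₙ∣n x) coprime)
        kx∈pieceₘ : T (piece m (mulZ n k x))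
        kx∈pieceₘ = subst (λ d → T (piece d (mulZ n k x))) gcd[kx]≡m kx∈piece

      countIn-piece : ∀ {d} → d ∣ n → T (B d) → countIn d (piece d) ≡ α n k d
      countIn-piece {d} d∣n Bd with cop n k d in c
      ... | true = begin
        countIn d (lookup (K d))  ≡⟨ sum-cong-≗ {n} (cong ⟦_⟧ ∘ inA∧K≡K) ⟩
        count (lookup (K d))      ≡⟨ ∣p∣≡count (K d) ⟨
        ∣ K d ∣                    ≡⟨ proj₂ (proj₂ (K-max d d∣n Bd (subst T (sym c) _))) ⟩
        RkSet n k (Adiv n d)      ∎
        where
        open ≡-Reasoning
        x∈K⇒x∈piece : ∀ {x} → T (lookup (K d) x) → T (piece d x)
        x∈K⇒x∈piece {x} = subst (λ b → T (if b then lookup (K d) x else lookup (Adiv n d) x)) (sym c)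
        inA∧K≡K : ∀ x → does (gcdₙ x ≟ d) ∧ lookup (K d) x ≡ lookup (K d) x
        inA∧K≡K x = T-ext (proj₂ ∘ Equivalence.to T-∧) λ x∈K →
          Equivalence.from T-∧ (≡⇒≡ᵇ (gcdₙ x) d (piece⇒gcdₙ d∣n Bd (x∈K⇒x∈piece x∈K)) , x∈K)
      ... | false = begin
        countIn d (lookup (Adiv n d))              ≡⟨ sum-cong-≗ {n} (cong ⟦_⟧ ∘ inA∧A≡inA) ⟩
        count (λ x → does (gcdₙ x ≟ d))           ≡⟨ count-Adiv d∣n ⟩
        φ (n /ᵈ d)                                ∎
        where
        open ≡-Reasoning
        inA∧A≡inA : ∀ x → does (gcdₙ x ≟ d) ∧ lookup (Adiv n d) x ≡ does (gcdₙ x ≟ d)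
        inA∧A≡inA x = trans (cong (does (gcdₙ x ≟ d) ∧_) (lookup-Adiv d x)) (∧-idem _)

      countIn-B̄ : ∀ {d} → d ∣ n → countIn d (lookup B̄) ≡ ⟦ B d ⟧ * α n k d
      countIn-B̄ {d} d∣n = begin
        countIn d (lookup B̄)            ≡⟨ sum-cong-≗ {n} (cong ⟦_⟧ ∘ pointwise) ⟩
        count (λ x → B d ∧ inPiece x)   ≡⟨ count-const-∧ (B d) inPiece ⟩
        ⟦ B d ⟧ * count inPiece         ≡⟨ ⟦b⟧*-cong (B d) (countIn-piece d∣n) ⟩
        ⟦ B d ⟧ * α n k d               ∎
        where
        open ≡-Reasoning
        inPiece : Fin n → Bool
        inPiece x = does (gcdₙ x ≟ d) ∧ piece d x
        pointwise : ∀ x → does (gcdₙ x ≟ d) ∧ lookup B̄ x ≡ B d ∧ (does (gcdₙ x ≟ d) ∧ piece d x)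
        pointwise x rewrite lookup-B̄ x with gcdₙ x ≟ d
        ... | yes g≡d rewrite dec-true (gcdₙ x ≟ d) g≡d = cong (λ g → B g ∧ piece g x) g≡d
        ... | no g≢d rewrite dec-false (gcdₙ x ≟ d) g≢d = sym (∧-zeroʳ (B d))

      ∣B̄∣≡ : ∣ B̄ ∣ ≡ divisorSum (λ d → ⟦ B d ⟧ * α n k d)
      ∣B̄∣≡ = trans (∣p∣≡count B̄) (trans (count-by-gcdₙ (lookup B̄)) (divisorSum-cong λ _ → countIn-B̄))

proposition3 : (n k : ℕ) {{_ : NonZero n}} → 0 < k → gcd k n ≢ 1 →
    (B : ℕ → Bool) → IsProcedureSet n k B →
    (K : ℕ → Subset n) →
    (∀ m → m ∣ n → T (B m) → T (cop n k m) → IsMaxKFreeIn n k (Adiv n m) (K m)) →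
    KFree n k (Bbar n k B K) × ∣ Bbar n k B K ∣ ≡ Rk n k ×
    Rk n k ≡ sumNonCop n k B + sumCop n k B
proposition3 n k _ _ B procedure K K-max = B̄-kfree′ , trans ∣B̄∣≡Σ (sym Rk≡Σ) , Rk≡Σ
  where
  Σ = sumNonCop n k B + sumCop n k B
  B̄-kfree′ : KFree n k (Bbar n k B K)
  B̄-kfree′ = B̄-kfree n k B procedure K K-max
  ∣B̄∣≡Σ : ∣ Bbar n k B K ∣ ≡ Σ
  ∣B̄∣≡Σ = trans (∣B̄∣≡ n k B procedure K K-max) (sym (sumNonCop+sumCop≡ n k B))
  Rk≤Σ : Rk n k ≤ Σ
  Rk≤Σ = RkSet-upper n k λ S _ S-kfree →
    subst (∣ S ∣ ≤_) (sym (sumNonCop+sumCop≡ n k B)) (kFree-bound n k B procedure S S-kfree)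
  Rk≡Σ : Rk n k ≡ Σ
  Rk≡Σ = ≤-antisym Rk≤Σ (subst (_≤ Rk n k) ∣B̄∣≡Σ (RkSet-lower n k ⊆⊤ B̄-kfree′))
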